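{- Let $\sigma$ be a modal signature. If $T_c\in\mathcal{C}_\sigma$, then there is a $\mathcal{PG}$-augmentation $T'_c$ of $T_c$.
   Context: A modal signature is $\sigma = \mathrm{Prop} \cup \mathbb{A}$, where $\mathrm{Prop}$ is a finite set of unary relation symbols (proposition letters) and $\mathbb{A} = \{R_i \mid i \in I\}$ ($I$ finite) is a finite set of binary relation symbols (actions). $\sigma_B=\mathrm{Prop}\cup\mathbb{A}\cup\{B_i\mid i\in I\}$ with fresh binary symbols $B_i$. A $\sigma$-LTS is a $\sigma$-structure with one distinguished element. A $\sigma$-LTS is connected if the undirected graph on its domain with an edge between $m$ and $n$ whenever some binary fact involves $m$ and $n$ is connected; $\mathcal{C}_\sigma$ is the class of finite connected $\sigma$-LTSs. A $\sigma_B$-LTS $T'_c$ is point-generated if every state is reachable from $c$ by a directed path $c=b_0,\dots,b_\ell$ with, for each $j$, $R(b_j,b_{j+1})$ for some binary $R\in\sigma_B$; $\mathcal{PG}_{\sigma_B}$ is the class of finite point-generated $\sigma_B$-LTSs. For $T_c\in\mathcal{C}_\sigma$, a $\mathcal{PG}$-augmentation of $T_c$ is a $T'_c\in\mathcal{PG}_{\sigma_B}$ with the same domain, the same interpretation of proposition letters and the same distinguished element, such that for each $i\in I$ there is $X_i\subseteq R_i^T$ with $R_i^{T'}=R_i^T\setminus X_i$ and $B_i^{T'}=X_i^{ -1}$ (i.e., $T'_c$ arises by replacing some $R_i$-transitions by $B_i$-transitions in the opposite direction). -}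

module Defs where

open import Data.Nat using (ℕ)
open import Data.Fin using (Fin)
open import Data.Bool using (Bool; true; false; _∧_; not)
open import Data.Product using (Σ; ∃; _×_; _,_)
open import Data.Sum using (_⊎_)
open import Relation.Binary.PropositionalEquality using (_≡_)
open import Relation.Binary.Construct.Closure.ReflexiveTransitive using (Star)

-- A finite σ-LTS for the modal signature σ = Prop ∪ 𝔸 with
--   Prop = Fin P  (proposition letters),  I = Fin k  (action indices),
-- domain Fin n, unary/binary relations as (decidable) Bool-valued predicates,
-- and a distinguished element.
record LTS (P k n : ℕ) : Set where
  field
    val   : Fin P → Fin n → Bool
    rel   : Fin k → Fin n → Fin n → Bool
    point : Fin n

-- A finite σ_B-LTS: additionally the fresh binary symbols B_i.
record LTSB (P k n : ℕ) : Set where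
  field
    val   : Fin P → Fin n → Bool
    rel   : Fin k → Fin n → Fin n → Bool
    brel  : Fin k → Fin n → Fin n → Bool
    point : Fin n

data UEdge {P k n : ℕ} (T : LTS P k n) (a b : Fin n) : Set where
  fwd : (i : Fin k) → LTS.rel T i a b ≡ true → UEdge T a b
  bwd : (i : Fin k) → LTS.rel T i b a ≡ true → UEdge T a b

Connected : {P k n : ℕ} → LTS P k n → Set
Connected {n = n} T = (a b : Fin n) → Star (UEdge T) a b

data DEdge {P k n : ℕ} (T : LTSB P k n) (a b : Fin n) : Set where
  viaR : (i : Fin k) → LTSB.rel T i a b ≡ true → DEdge T a b
  viaB : (i : Fin k) → LTSB.brel T i a b ≡ true → DEdge T a b

PointGenerated : {P k n : ℕ} → LTSB P k n → Set
PointGenerated {n = n} T = (a : Fin n) → Star (DEdge T) (LTSB.point T) a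

IsPGAugmentation : {P k n : ℕ} → LTS P k n → LTSB P k n → Set
IsPGAugmentation {P} {k} {n} T T' =
  ((p : Fin P) (a : Fin n) → LTSB.val T' p a ≡ LTS.val T p a)
  × (LTSB.point T' ≡ LTS.point T)
  × Σ (Fin k → Fin n → Fin n → Bool) (λ X →
      ((i : Fin k) (a b : Fin n) → X i a b ≡ true → LTS.rel T i a b ≡ true)
      × ((i : Fin k) (a b : Fin n) → LTSB.rel T' i a b ≡ (LTS.rel T i a b ∧ not (X i a b)))
      × ((i : Fin k) (a b : Fin n) → LTSB.brel T' i a b ≡ X i b a))
  × PointGenerated T'

-- Orient the graph by breadth-first distance from the point c: an R_i-edge
-- that leads strictly closer to c is replaced by the reversed B_i-edge, every
-- other edge is kept. Then each state a ≠ c, having a neighbour one step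
-- closer to c, receives a directed edge from that neighbour, and induction on
-- the distance makes every state reachable from c.
module Submission where

open import Defs
open import Data.Nat using (ℕ; zero; suc; _<_; _≤_; _<?_; s≤s)
open import Data.Nat.Properties using (≮⇒≥; <-asym; n<1+n)
open import Data.Nat.Induction using (<-wellFounded)
open import Data.Fin using (Fin; _≟_)
open import Data.Fin.Properties using (any?)
open import Data.Bool using (Bool; true; _∧_; not)
import Data.Bool as Bool
open import Data.Product using (Σ; ∃; _×_; _,_)
open import Data.Sum using (_⊎_; inj₁; inj₂)
open import Induction.WellFounded using (module All)
open import Relation.Binary.Construct.On as On using ()
open import Relation.Nullary using (Dec; does; yes; no; ¬_; contradiction)
open import Relation.Nullary.Decidable using (dec-true; dec-false; _×-dec_; _⊎-dec_; map′)
open import Relation.Unary using (Decidable)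
open import Relation.Binary.PropositionalEquality using (_≡_; refl; cong₂)
open import Relation.Binary.Construct.Closure.ReflexiveTransitive using (Star; ε; _◅_; _◅◅_)

∧≡true⇒ˡ≡true : ∀ {x y : Bool} → x ∧ y ≡ true → x ≡ true
∧≡true⇒ˡ≡true {true} _ = refl

record Least (Q : ℕ → Set) : Set where
  field
    value : ℕ
    holds : Q value
    below : ∀ {d} → d < value → ¬ Q d

least : {Q : ℕ → Set} → Decidable Q → ∀ {D} → Q D → Least Q
least Q? {D} qD with Q? 0
... | yes q0 = record { value = 0 ; holds = q0 ; below = λ () }
least Q? {zero}  qD | no ¬q0 = contradiction qD ¬q0
least {Q} Q? {suc D} qD | no ¬q0 = record { value = suc value ; holds = holds ; below = below′ }
  where
  open Least (least (λ d → Q? (suc d)) qD)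
  below′ : ∀ {d} → d < suc value → ¬ Q d
  below′ {zero}  _       = ¬q0
  below′ {suc d} (s≤s p) = below p

module _ {P k n : ℕ} (T : LTS P k n) where
  open LTS T

  uEdge? : ∀ a b → Dec (UEdge T a b)
  uEdge? a b = map′ toEdge fromEdge (any? (λ i → rel i a b Bool.≟ true) ⊎-dec any? (λ i → rel i b a Bool.≟ true))
    where
    toEdge : (∃ λ i → rel i a b ≡ true) ⊎ (∃ λ i → rel i b a ≡ true) → UEdge T a b
    toEdge (inj₁ (i , p)) = fwd i p
    toEdge (inj₂ (i , p)) = bwd i p
    fromEdge : UEdge T a b → (∃ λ i → rel i a b ≡ true) ⊎ (∃ λ i → rel i b a ≡ true)
    fromEdge (fwd i p) = inj₁ (i , p)
    fromEdge (bwd i p) = inj₂ (i , p)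

  Descending : (Fin n → ℕ) → Set
  Descending f = ∀ a → a ≡ point ⊎ ∃ λ b → UEdge T a b × f b < f a

  Within : ℕ → Fin n → Set
  Within zero    a = a ≡ point
  Within (suc d) a = Within d a ⊎ ∃ λ b → UEdge T a b × Within d b

  within? : ∀ d → Decidable (Within d)
  within? zero    a = a ≟ point
  within? (suc d) a = within? d a ⊎-dec any? (λ b → uEdge? a b ×-dec within? d b)

  path⇒within : ∀ {a} → Star (UEdge T) a point → ∃ λ d → Within d a
  path⇒within ε        = 0 , refl
  path⇒within (e ◅ es) with path⇒within es
  ... | d , w = suc d , inj₂ (_ , e , w)

  module Distance (conn : Connected T) where

    distance : (a : Fin n) → Least (λ d → Within d a)
    distance a with path⇒within (conn a point)
    ... | _ , w = least (λ d → within? d a) w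

    dist : Fin n → ℕ
    dist a = Least.value (distance a)

    dist-minimal : ∀ {d b} → Within d b → dist b ≤ d
    dist-minimal {b = b} w = ≮⇒≥ (λ d<dist → Least.below (distance b) d<dist w)

    descend : ∀ m a → Within m a → (∀ {d} → d < m → ¬ Within d a) →
              a ≡ point ⊎ ∃ λ b → UEdge T a b × dist b < m
    descend zero    a a≡point           _     = inj₁ a≡point
    descend (suc d) a (inj₁ w)          below = contradiction w (below (n<1+n d))
    descend (suc d) a (inj₂ (b , e , w)) _    = inj₂ (b , e , s≤s (dist-minimal w))

    dist-descending : Descending dist
    dist-descending a = descend (dist a) a (Least.holds (distance a)) (Least.below (distance a))

  augment : (Fin k → Fin n → Fin n → Bool) → LTSB P k n
  augment X = record
    { val   = val
    ; rel   = λ i a b → rel i a b ∧ not (X i a b)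
    ; brel  = λ i a b → X i b a
    ; point = point
    }

  module Orientation (f : Fin n → ℕ) where

    downhill : Fin k → Fin n → Fin n → Bool
    downhill i a b = rel i a b ∧ does (f b <? f a)

    T′ : LTSB P k n
    T′ = augment downhill

    reversed-edge : ∀ {a b} → UEdge T a b → f b < f a → DEdge T′ b a
    reversed-edge {a} {b} (fwd i p) fb<fa = viaB i (cong₂ _∧_ p (dec-true (f b <? f a) fb<fa))
    reversed-edge {a} {b} (bwd i p) fb<fa =
      viaR i (cong₂ (λ r d → r ∧ not (r ∧ d)) p (dec-false (f a <? f b) (<-asym fb<fa)))

    pointGenerated : Descending f → PointGenerated T′
    pointGenerated desc = All.wfRec (On.wellFounded f <-wellFounded) _ (Star (DEdge T′) point) reach
      where
      reach : ∀ a → (∀ {b} → f b < f a → Star (DEdge T′) point b) → Star (DEdge T′) point a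
      reach a ih with desc a
      ... | inj₁ refl              = ε
      ... | inj₂ (b , e , fb<fa) = ih fb<fa ◅◅ (reversed-edge e fb<fa ◅ ε)

    isPGAugmentation : Descending f → IsPGAugmentation T T′
    isPGAugmentation desc =
      (λ _ _ → refl) , refl ,
      (downhill , (λ _ _ _ → ∧≡true⇒ˡ≡true) , (λ _ _ _ → refl) , (λ _ _ _ → refl)) ,
      pointGenerated desc

proposition5p8 : {P k n : ℕ} (T : LTS P k n) → Connected T →
    Σ (LTSB P k n) (λ T' → IsPGAugmentation T T')
proposition5p8 T conn = T′ , isPGAugmentation dist-descending
  where
  open Distance T conn
  open Orientation T dist
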